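{- Let $G_\tau$ be a bidirected graph. Then every transitive reduction of $G_\tau$ is a transitive reduction of $\mathrm{Ft}(G_\tau)$.
   Context: A graph $G=(V,E)$ is finite, with loops and multiple edges allowed. A half-edge is a pair $(e,x)$ with $e$ incident with $x$ (a loop has two half-edges at its vertex). A bidirected graph $G_\tau=(V,E;\tau)$ is a graph with a map $\tau$ assigning $+1$ or $-1$ to every half-edge; an edge with ends $x,y$ and $\tau(e,x)=\alpha,\tau(e,y)=\beta$ is written $\{x^\alpha,y^\beta\}$. A partial graph of $G_\tau$ is $(V,F;\tau|_F)$ with $F\subseteq E$. A chain is $x_0,e_1,x_1,\ldots,e_k,x_k$ where $e_i$ has ends $x_{i-1},x_i$; when $e_i$ is traversed from $x_{i-1}$ to $x_i$, $\tau(e_i,x_{i-1}),\tau(e_i,x_i)$ denote the values at the corresponding half-edges. For $\alpha,\beta\in\{\pm1\}$ a b-walk from $x^\alpha$ to $y^\beta$ is a chain $x=x_0,e_1,\ldots,e_k,x_k=y$ with $k\ge1$, $\tau(e_1,x_0)=\alpha$, $\tau(e_k,x_k)=\beta$ and $\tau(e_i,x_i)+\tau(e_{i+1},x_i)=0$ for $1\le i\le k-1$. A b-path from $x^\alpha$ to $y^\beta$ is a b-walk from $x^\alpha$ to $y^\beta$ minimal with these properties (no b-walk from $x^\alpha$ to $y^\beta$ has as edge sequence a proper subsequence, in the same order, of its edge sequence); $x=y$ allowed. The transitive closure $\mathrm{Ft}(G_\tau)$ is the bidirected graph on $V$ whose edges are those of $G_\tau$ together with an edge $\{x^\alpha,y^\beta\}$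 (a loop if $x=y$) for every $x^\alpha,y^\beta$ such that $G_\tau$ has a b-path from $x^\alpha$ to $y^\beta$. For a bidirected graph $K_\tau$ and a partial graph $H_\tau$ of $K_\tau$, $\mathrm{ft}(K_\tau;H_\tau)$ is the partial graph of $K_\tau$ whose edges are the edges of $K_\tau$ that are edges of $H_\tau$ or are of the form $\{x^\alpha,y^\beta\}$ with a b-path from $x^\alpha$ to $y^\beta$ in $H_\tau$. A transitive reduction of $K_\tau$ is a minimal partial graph $R$ of $K_\tau$ with $\mathrm{ft}(K_\tau;R)=K_\tau$. -}

module Defs where

open import Data.Nat using (ℕ)
open import Data.Fin using (Fin)
open import Data.Bool using (Bool; true; false)
open import Data.List using (List; []; _∷_; map)
open import Data.List.Relation.Binary.Sublist.Propositional using (_⊆_)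
open import Data.Product using (Σ; ∃; _×_; _,_; proj₁)
open import Data.Sum using (_⊎_; inj₁; inj₂)
open import Relation.Binary.PropositionalEquality using (_≡_; _≢_)
open import Relation.Nullary using (¬_)

data Sign : Set where
  plus minus : Sign

opp : Sign → Sign
opp plus  = minus
opp minus = plus

-- A bidirected graph on vertex set Fin n with edge set E.
-- Edge e is {end₁ e ^ τ₁ e , end₂ e ^ τ₂ e}; for a loop end₁ e ≡ end₂ e and
-- τ₁ e, τ₂ e are the values at its two half-edges.
record BiGraph (n : ℕ) (E : Set) : Set where
  field
    end₁ end₂ : E → Fin n
    τ₁ τ₂     : E → Sign

module _ {n : ℕ} {E : Set} (G : BiGraph n E) where
  open BiGraph G

  Step : Set
  Step = E × Bool

  src tgt : Step → Fin n
  src (e , true)  = end₁ e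
  src (e , false) = end₂ e
  tgt (e , true)  = end₂ e
  tgt (e , false) = end₁ e

  srcSign tgtSign : Step → Sign
  srcSign (e , true)  = τ₁ e
  srcSign (e , false) = τ₂ e
  tgtSign (e , true)  = τ₂ e
  tgtSign (e , false) = τ₁ e

  -- b-walk from x^α to y^β with the given step sequence (k ≥ 1)
  data BWalk : Fin n → Sign → Fin n → Sign → List Step → Set where
    one  : ∀ {x α y β} (s : Step) →
           src s ≡ x → srcSign s ≡ α → tgt s ≡ y → tgtSign s ≡ β →
           BWalk x α y β (s ∷ [])
    cons : ∀ {x α y β w} (s : Step) →
           src s ≡ x → srcSign s ≡ α →
           BWalk (tgt s) (opp (tgtSign s)) y β w →
           BWalk x α y β (s ∷ w)

  edges : List Step → List E
  edges = map proj₁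

  BPath : Fin n → Sign → Fin n → Sign → List Step → Set
  BPath x α y β w =
    BWalk x α y β w ×
    ¬ (Σ (List Step) λ w' → BWalk x α y β w' × (edges w' ⊆ edges w) × (edges w' ≢ edges w))

  HasBPath : Fin n → Sign → Fin n → Sign → Set
  HasBPath x α y β = Σ (List Step) (BPath x α y β)

  -- Edge type of the transitive closure: old edges, plus one edge {x^α,y^β}
  -- for each x^α,y^β admitting a b-path.
  FtEdge : Set
  FtEdge = E ⊎ Σ (Fin n × Sign × Fin n × Sign) λ { (x , α , y , β) → HasBPath x α y β }

  Ft : BiGraph n FtEdge
  BiGraph.end₁ Ft (inj₁ e) = end₁ e
  BiGraph.end₁ Ft (inj₂ ((x , α , y , β) , _)) = x
  BiGraph.end₂ Ft (inj₁ e) = end₂ e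
  BiGraph.end₂ Ft (inj₂ ((x , α , y , β) , _)) = y
  BiGraph.τ₁ Ft (inj₁ e) = τ₁ e
  BiGraph.τ₁ Ft (inj₂ ((x , α , y , β) , _)) = α
  BiGraph.τ₂ Ft (inj₁ e) = τ₂ e
  BiGraph.τ₂ Ft (inj₂ ((x , α , y , β) , _)) = β

module _ {n : ℕ} {E : Set} (G : BiGraph n E) where
  open BiGraph G

  -- A partial graph is given by its (decidable) edge subset F : E → Bool.
  Partial : (F : E → Bool) → BiGraph n (Σ E λ e → F e ≡ true)
  Partial F = record
    { end₁ = λ p → end₁ (proj₁ p) ; end₂ = λ p → end₂ (proj₁ p)
    ; τ₁ = λ p → τ₁ (proj₁ p) ; τ₂ = λ p → τ₂ (proj₁ p) }

  -- ft(G ; H) = G : every edge of G is an edge of H or is {x^α,y^β}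
  -- with a b-path from x^α to y^β in H (either orientation of the edge).
  FtCovers : (E → Bool) → Set
  FtCovers H = ∀ (e : E) →
    (H e ≡ true)
    ⊎ HasBPath (Partial H) (end₁ e) (τ₁ e) (end₂ e) (τ₂ e)
    ⊎ HasBPath (Partial H) (end₂ e) (τ₂ e) (end₁ e) (τ₁ e)

  IsTransitiveReduction : (E → Bool) → Set
  IsTransitiveReduction R =
    FtCovers R ×
    (∀ (R' : E → Bool) → (∀ e → R' e ≡ true → R e ≡ true) → FtCovers R' →
       ¬ (Σ E λ e → (R e ≡ true) × (R' e ≡ false)))

embedFt : ∀ {n : ℕ} {E : Set} (G : BiGraph n E) → (E → Bool) → FtEdge G → Bool
embedFt G R (inj₁ e) = R e
embedFt G R (inj₂ _) = false

-- Each edge of G lies in R or joins the ends of a b-path of R, so every b-walk of G can be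
-- rerouted through R; every b-walk contains a b-path, so each new edge of Ft(G) is spanned
-- by a b-path of R and R covers Ft(G). Conversely, a partial graph of Ft(G) inside R has
-- no new edges, so it is a partial graph of G with the same b-paths, and if it covers Ft(G)
-- it covers G; minimality of R in G therefore gives minimality in Ft(G).
module Submission where

open import Defs
open import Data.Nat using (ℕ; _<_; s≤s)
open import Data.Nat.Induction using (<-wellFounded)
open import Data.Nat.Properties using (≤-trans; n<1+n)
open import Data.Fin using (Fin; _≟_)
open import Data.Bool using (Bool; true; false)
open import Data.Bool.Properties using (¬-not)
open import Data.List using (List; []; _∷_; map; _++_; length)
open import Data.List.Membership.Propositional using (_∈_; find)
open import Data.List.Membership.Propositional.Properties using (∈-map⁻)
open import Data.List.Relation.Binary.Sublist.Propositional using (_⊆_; []; _∷_; _∷ʳ_)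
open import Data.List.Relation.Binary.Sublist.Propositional.Properties
  using ([]⊆-universal; length-mono-≤)
open import Data.List.Relation.Unary.Any using (Any; here; there; any?)
import Data.List.Relation.Unary.Any as Any
open import Data.List.Relation.Unary.Any.Properties using (map⁺)
open import Data.Product using (Σ; _×_; _,_; proj₁)
open import Data.Sum using (_⊎_; inj₁; inj₂; [_,_]; map₂)
import Data.Sum as Sum
open import Function using (_∘_; _⇔_; mk⇔)
open import Induction.WellFounded using (Acc; acc)
open import Relation.Binary.PropositionalEquality using (_≡_; _≢_; refl; sym; trans; cong; subst)
open import Relation.Nullary using (Dec; yes; no; ¬_; contradiction)
open import Relation.Nullary.Decidable using (_×-dec_; _⊎-dec_)
import Relation.Nullary.Decidable as Dec

opp-involutive : ∀ s → opp (opp s) ≡ s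
opp-involutive plus  = refl
opp-involutive minus = refl

_≟ₛ_ : (a b : Sign) → Dec (a ≡ b)
plus  ≟ₛ plus  = yes refl
plus  ≟ₛ minus = no λ ()
minus ≟ₛ plus  = no λ ()
minus ≟ₛ minus = yes refl

deletions : ∀ {A : Set} → List A → List (List A)
deletions []       = []
deletions (a ∷ as) = as ∷ map (a ∷_) (deletions as)

length-∈-deletions : ∀ {A : Set} {zs ys : List A} → zs ∈ deletions ys →
                     length zs < length ys
length-∈-deletions {ys = y ∷ ys} (here refl) = n<1+n (length ys)
length-∈-deletions {ys = y ∷ ys} (there zs∈) with ∈-map⁻ (y ∷_) zs∈
... | _ , zs′∈ , refl = s≤s (length-∈-deletions zs′∈)

proper-sublist⇒⊆-deletion : ∀ {A : Set} {xs ys : List A} → xs ⊆ ys → xs ≢ ys →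
                            Any (xs ⊆_) (deletions ys)
proper-sublist⇒⊆-deletion []           xs≢ys = contradiction refl xs≢ys
proper-sublist⇒⊆-deletion (y ∷ʳ xs⊆ys) _ = here xs⊆ys
proper-sublist⇒⊆-deletion {xs = x ∷ xs} (refl ∷ xs⊆ys) xs≢ys =
  there (map⁺ (Any.map (refl ∷_) (proper-sublist⇒⊆-deletion xs⊆ys (xs≢ys ∘ cong (x ∷_)))))

module _ {n : ℕ} {E : Set} (G : BiGraph n E) where

  HasBWalk : Fin n → Sign → Fin n → Sign → Set
  HasBWalk x α y β = Σ (List (Step G)) (BWalk G x α y β)

  hasBPath⇒hasBWalk : ∀ {x α y β} → HasBPath G x α y β → HasBWalk x α y β
  hasBPath⇒hasBWalk (w , walk , _) = w , walk

  bwalk-++ : ∀ {x α y β z γ w w′} → BWalk G x α y β w → BWalk G y (opp β) z γ w′ →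
             BWalk G x α z γ (w ++ w′)
  bwalk-++ (one s p q refl refl) walk′ = cons s p q walk′
  bwalk-++ (cons s p q walk)     walk′ = cons s p q (bwalk-++ walk walk′)

  hasBWalk-trans : ∀ {x α y β z γ} → HasBWalk x α y β → HasBWalk y (opp β) z γ →
                   HasBWalk x α z γ
  hasBWalk-trans (w , walk) (w′ , walk′) = w ++ w′ , bwalk-++ walk walk′

  reverseStep : (s : Step G) → HasBWalk (tgt G s) (tgtSign G s) (src G s) (srcSign G s)
  reverseStep (e , true)  = _ , one (e , false) refl refl refl refl
  reverseStep (e , false) = _ , one (e , true) refl refl refl refl

  hasBWalk-reverse : ∀ {x α y β} → HasBWalk x α y β → HasBWalk y β x α
  hasBWalk-reverse (_ , one s refl refl refl refl) = reverseStep s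
  hasBWalk-reverse (_ , cons s refl refl walk) =
    hasBWalk-trans (hasBWalk-reverse (_ , walk))
      (subst (λ γ → HasBWalk (tgt G s) γ (src G s) (srcSign G s))
             (sym (opp-involutive (tgtSign G s))) (reverseStep s))

  WalkWithin : Fin n → Sign → Fin n → Sign → List E → Set
  WalkWithin x α y β L = Σ (List (Step G)) λ w → BWalk G x α y β w × edges G w ⊆ L

  StartsWithin : Step G → Fin n → Sign → Fin n → Sign → List E → Set
  StartsWithin s x α y β L =
    src G s ≡ x × srcSign G s ≡ α ×
    ((tgt G s ≡ y × tgtSign G s ≡ β) ⊎ WalkWithin (tgt G s) (opp (tgtSign G s)) y β L)

  walkWithin-∷ : ∀ {x α y β e L} →
    (WalkWithin x α y β L ⊎ StartsWithin (e , true) x α y β L ⊎ StartsWithin (e , false) x α y β L)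
    ⇔ WalkWithin x α y β (e ∷ L)
  walkWithin-∷ {e = e} = mk⇔ [ skip , [ startWith {e , true} , startWith {e , false} ] ] split
    where
    skip : ∀ {x α y β L} → WalkWithin x α y β L → WalkWithin x α y β (e ∷ L)
    skip (w , walk , w⊆L) = w , walk , e ∷ʳ w⊆L

    startWith : ∀ {s x α y β L} → StartsWithin s x α y β L → WalkWithin x α y β (proj₁ s ∷ L)
    startWith {s} {L = L} (p , q , inj₁ (r , t)) = s ∷ [] , one s p q r t , refl ∷ []⊆-universal L
    startWith {s} (p , q , inj₂ (w , walk , w⊆L)) = s ∷ w , cons s p q walk , refl ∷ w⊆L

    starts : ∀ {s w x α y β L} → BWalk G x α y β (s ∷ w) → edges G w ⊆ L →
             StartsWithin s x α y β L
    starts (one _ p q r t)   _   = p , q , inj₁ (r , t)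
    starts (cons _ p q walk) w⊆L = p , q , inj₂ (_ , walk , w⊆L)

    split : ∀ {x α y β L} → WalkWithin x α y β (e ∷ L) →
            WalkWithin x α y β L ⊎
            StartsWithin (e , true) x α y β L ⊎ StartsWithin (e , false) x α y β L
    split ([] , () , _)
    split (s ∷ w , walk , _ ∷ʳ sw⊆L)             = inj₁ (s ∷ w , walk , sw⊆L)
    split ((_ , true)  ∷ w , walk , refl ∷ w⊆L) = inj₂ (inj₁ (starts walk w⊆L))
    split ((_ , false) ∷ w , walk , refl ∷ w⊆L) = inj₂ (inj₂ (starts walk w⊆L))

  walkWithin? : ∀ x α y β L → Dec (WalkWithin x α y β L)
  walkWithin? x α y β []      = no λ { (_ , one _ _ _ _ _ , ()) ; (_ , cons _ _ _ _ , ()) }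
  walkWithin? x α y β (e ∷ L) =
    Dec.map walkWithin-∷
      (walkWithin? x α y β L ⊎-dec startsWithin? (e , true) ⊎-dec startsWithin? (e , false))
    where
    startsWithin? : ∀ s → Dec (StartsWithin s x α y β L)
    startsWithin? s = src G s ≟ x ×-dec srcSign G s ≟ₛ α ×-dec
      ((tgt G s ≟ y ×-dec tgtSign G s ≟ₛ β) ⊎-dec walkWithin? (tgt G s) (opp (tgtSign G s)) y β L)

  -- Pass to a b-walk inside a one-edge deletion of the edge sequence while one exists; a
  -- b-walk on a proper subsequence would lie inside some deletion, so at the end none exists.
  hasBWalk⇒hasBPath : ∀ {x α y β} → HasBWalk x α y β → HasBPath G x α y β
  hasBWalk⇒hasBPath (w , walk) = shorten w walk (<-wellFounded _)
    where
    shorten : ∀ {x α y β} w → BWalk G x α y β w → Acc _<_ (length (edges G w)) →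
              HasBPath G x α y β
    shorten {x} {α} {y} {β} w walk (acc shorter)
      with any? (walkWithin? x α y β) (deletions (edges G w))
    ... | yes within with find within
    ...   | zs , zs∈ , w′ , walk′ , w′⊆zs =
      shorten w′ walk′ (shorter (≤-trans (s≤s (length-mono-≤ w′⊆zs)) (length-∈-deletions zs∈)))
    shorten w walk _ | no none = w , walk , λ (w′ , walk′ , w′⊆w , w′≢w) →
      none (Any.map (λ w′⊆zs → w′ , walk′ , w′⊆zs) (proper-sublist⇒⊆-deletion w′⊆w w′≢w))

module _ {n : ℕ} {E₁ E₂ : Set} (G : BiGraph n E₁) (H : BiGraph n E₂) where

  StepSimulation : Set
  StepSimulation = (s : Step G) → HasBWalk H (src G s) (srcSign G s) (tgt G s) (tgtSign G s)

  simulate : StepSimulation → ∀ {x α y β} → HasBWalk G x α y β → HasBWalk H x α y β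
  simulate sim (_ , one s refl refl refl refl) = sim s
  simulate sim (_ , cons s refl refl walk) = hasBWalk-trans H (sim s) (simulate sim (_ , walk))

  hasBPath-transport : StepSimulation → ∀ {x α y β} → HasBPath G x α y β → HasBPath H x α y β
  hasBPath-transport sim = hasBWalk⇒hasBPath H ∘ simulate sim ∘ hasBPath⇒hasBWalk G

stepSimulation-∘ : ∀ {n : ℕ} {E₁ E₂ E₃ : Set}
  {G : BiGraph n E₁} {H : BiGraph n E₂} {K : BiGraph n E₃} →
  StepSimulation H K → StepSimulation G H → StepSimulation G K
stepSimulation-∘ {H = H} {K} simHK simGH = simulate H K simHK ∘ simGH

covers⇒stepSimulation : ∀ {n : ℕ} {E : Set} (G : BiGraph n E) (R : E → Bool) →
  FtCovers G R → StepSimulation G (Partial G R)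
covers⇒stepSimulation G R covers (e , true) with covers e
... | inj₁ Re             = _ , one ((e , Re) , true) refl refl refl refl
... | inj₂ (inj₁ forward)  = hasBPath⇒hasBWalk _ forward
... | inj₂ (inj₂ backward) = hasBWalk-reverse _ (hasBPath⇒hasBWalk _ backward)
covers⇒stepSimulation G R covers (e , false) with covers e
... | inj₁ Re             = _ , one ((e , Re) , false) refl refl refl refl
... | inj₂ (inj₁ forward)  = hasBWalk-reverse _ (hasBPath⇒hasBWalk _ forward)
... | inj₂ (inj₂ backward) = hasBPath⇒hasBWalk _ backward

module _ {n : ℕ} {E : Set} (G : BiGraph n E) where

  OldEdges : (FtEdge G → Bool) → E → Bool
  OldEdges S e = S (inj₁ e)

  NoNewEdges : (FtEdge G → Bool) → Set
  NoNewEdges S = ∀ q → S (inj₂ q) ≡ false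

  oldEdges-stepSimulation : (S : FtEdge G → Bool) →
    StepSimulation (Partial G (OldEdges S)) (Partial (Ft G) S)
  oldEdges-stepSimulation S ((e , Se) , true)  = _ , one ((inj₁ e , Se) , true) refl refl refl refl
  oldEdges-stepSimulation S ((e , Se) , false) = _ , one ((inj₁ e , Se) , false) refl refl refl refl

  noNewEdges-stepSimulation : (S : FtEdge G → Bool) → NoNewEdges S →
    StepSimulation (Partial (Ft G) S) (Partial G (OldEdges S))
  noNewEdges-stepSimulation S _ ((inj₁ e , Se) , true) = _ , one ((e , Se) , true) refl refl refl refl
  noNewEdges-stepSimulation S _ ((inj₁ e , Se) , false) =
    _ , one ((e , Se) , false) refl refl refl refl
  noNewEdges-stepSimulation S noNew ((inj₂ q , Sq) , _) =
    contradiction (trans (sym Sq) (noNew q)) λ ()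

  embedFt-covers : (R : E → Bool) → FtCovers G R → FtCovers (Ft G) (embedFt G R)
  embedFt-covers R covers (inj₁ e) = map₂ (Sum.map transport transport) (covers e)
    where
    transport : ∀ {x α y β} → HasBPath (Partial G R) x α y β →
                HasBPath (Partial (Ft G) (embedFt G R)) x α y β
    transport = hasBPath-transport _ _ (oldEdges-stepSimulation (embedFt G R))
  embedFt-covers R covers (inj₂ (_ , path)) = inj₂ (inj₁ (hasBPath-transport _ _ reroute path))
    where
    reroute : StepSimulation G (Partial (Ft G) (embedFt G R))
    reroute = stepSimulation-∘ (oldEdges-stepSimulation (embedFt G R))
                               (covers⇒stepSimulation G R covers)

  oldEdges-covers : (S : FtEdge G → Bool) → NoNewEdges S →
    FtCovers (Ft G) S → FtCovers G (OldEdges S)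
  oldEdges-covers S noNew covers e = map₂ (Sum.map transport transport) (covers (inj₁ e))
    where
    transport : ∀ {x α y β} → HasBPath (Partial (Ft G) S) x α y β →
                HasBPath (Partial G (OldEdges S)) x α y β
    transport = hasBPath-transport _ _ (noNewEdges-stepSimulation S noNew)

  ⊆embedFt⇒noNewEdges : (R : E → Bool) (S : FtEdge G → Bool) →
    (∀ e → S e ≡ true → embedFt G R e ≡ true) → NoNewEdges S
  ⊆embedFt⇒noNewEdges R S S⊆R q = ¬-not λ Sq → contradiction (S⊆R (inj₂ q) Sq) λ ()

proposition45 : ∀ {n m : ℕ} (G : BiGraph n (Fin m)) (R : Fin m → Bool) →
    IsTransitiveReduction G R →
    IsTransitiveReduction (Ft G) (embedFt G R)
proposition45 G R (covers , minimal) = embedFt-covers G R covers , minimalFt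
  where
  minimalFt : ∀ (S : FtEdge G → Bool) → (∀ e → S e ≡ true → embedFt G R e ≡ true) →
              FtCovers (Ft G) S → ¬ Σ (FtEdge G) λ e → (embedFt G R e ≡ true) × (S e ≡ false)
  minimalFt S S⊆R coversS (inj₁ e , Re , Se) =
    minimal (OldEdges G S) (S⊆R ∘ inj₁)
      (oldEdges-covers G S (⊆embedFt⇒noNewEdges G R S S⊆R) coversS) (e , Re , Se)
  minimalFt _ _ _ (inj₂ _ , () , _)
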